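{- Let $W_{\Delta,n}$ be a Knödel graph with $\Delta\ge3$ and $n\ge(2\Delta-5)(2^{\Delta}-2)+4$. Then \[\operatorname{diam}(W_{\Delta,n})=1+\left\lceil\frac{n-2}{2^{\Delta}-2}\right\rceil.\]
   Context: Knödel graph: for an even integer $n$ and an integer $\Delta$ with $1\le\Delta\le\lfloor\log_2 n\rfloor$, $W_{\Delta,n}$ is the simple bipartite graph with vertex set $U\cup V$, $U=\{u_0,\dots,u_{n/2-1}\}$, $V=\{v_0,\dots,v_{n/2-1}\}$; indices are read modulo $n/2$. The vertices $u_i$ and $v_j$ are adjacent iff $j-i\equiv 2^k-1\pmod{n/2}$ for some $k\in\{0,\dots,\Delta-1\}$; no other edges. $\operatorname{diam}$ is the largest graph distance between two vertices. -}

module Defs where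

open import Data.Nat using (ℕ; zero; suc; _+_; _*_; _∸_; _^_; _≤_; _<_)
open import Data.Nat.DivMod using (_/_)
open import Data.Fin using (Fin; toℕ)
open import Data.Sum using (_⊎_; inj₁; inj₂)
open import Data.Product using (Σ; ∃; _×_; _,_)
open import Data.Empty using (⊥)
open import Relation.Binary.PropositionalEquality using (_≡_)

-- Ceiling division ⌈a / b⌉ (value 0 when b = 0; never used with b = 0).
ceilDiv : ℕ → ℕ → ℕ
ceilDiv a zero    = 0
ceilDiv a (suc b) = (a + b) / suc b

-- Vertices of W_{Δ,n} with m = n/2: inj₁ i = u_i, inj₂ j = v_j.
Vertex : ℕ → Set
Vertex m = Fin m ⊎ Fin m

-- j - i ≡ 2^k - 1 (mod m), i.e. j ≡ i + (2^k - 1) (mod m), with 0 ≤ j < m.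
UVAdj : (m Δ : ℕ) → Fin m → Fin m → Set
UVAdj m Δ i j = Σ ℕ λ k → k < Δ × Σ ℕ λ q → toℕ i + (2 ^ k ∸ 1) ≡ q * m + toℕ j

KAdj : (m Δ : ℕ) → Vertex m → Vertex m → Set
KAdj m Δ (inj₁ i) (inj₂ j) = UVAdj m Δ i j
KAdj m Δ (inj₂ j) (inj₁ i) = UVAdj m Δ i j
KAdj m Δ (inj₁ _) (inj₁ _) = ⊥
KAdj m Δ (inj₂ _) (inj₂ _) = ⊥

data Walk {V : Set} (Adj : V → V → Set) : V → V → ℕ → Set where
  here : ∀ {x} → Walk Adj x x 0
  step : ∀ {x y z ℓ} → Adj x y → Walk Adj y z ℓ → Walk Adj x z (suc ℓ)

IsDist : {V : Set} (Adj : V → V → Set) → V → V → ℕ → Set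
IsDist Adj x y d = Walk Adj x y d × (∀ ℓ → Walk Adj x y ℓ → d ≤ ℓ)

IsDiameter : {V : Set} (Adj : V → V → Set) → ℕ → Set
IsDiameter {V} Adj D =
  (∀ (x y : V) → Σ ℕ λ d → IsDist Adj x y d × d ≤ D)
  × Σ V λ x → Σ V λ y → IsDist Adj x y D

module Submission where

-- Write Δ = K + 2, n = 2m, gap k = 2^k - 1 and M = gap (K + 1), so 2^Δ - 2 = 2M.
-- Along a walk a step u_i → v_j adds a gap to the index and a step v_j → u_i
-- subtracts one (mod m).  Writing a subtracted gap a as (M - a) - M, the index
-- after ℓ steps is  i + E - bM  (mod m), where b is the number of backward steps and
-- E is a sum of f gaps and b complements M - a, with f + b = ℓ.
--
-- After generic preliminaries (walks and distances in decidable graphs, the sides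
-- and step counts of walks, congruences mod m), module Sums shows that for f ≥ K and
-- f + b ≥ 2K every E with 2E ≤ (f + b) M is such a sum.  Module Knödel proves the
-- displacement invariant (every walk yields such an E ≤ ℓ M) and its converse, so
-- for ℓ ≥ 2K and m ≤ ℓ M + 1 all vertices on the right side are reached by walks
-- of length ℓ (a displacement e with 2e > ℓ M is realised by the reverse walk with
-- ℓ M - e).  For c = ⌈(m - 1)/M⌉ ≥ 2K this bounds every distance by c + 1, while
-- the invariant puts the vertex with index ⌊c/2⌋ M + 1 at distance exactly c + 1
-- from u_0.

open import Defs
open import Data.Nat using (ℕ; _+_; _*_; _∸_; _^_; _≤_; _/_)
open import Data.Nat using (zero; suc; _<_; z≤n; s≤s; s≤s⁻¹; z<s; NonZero; _%_; _≤?_)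
open import Data.Nat using (⌊_/2⌋; ⌈_/2⌉)
open import Data.Nat.Properties
open import Data.Nat.Divisibility using (_∣_; divides)
open import Data.Nat.DivMod
open import Data.Nat.Tactic.RingSolver using (solve-∀)
open import Data.Fin using (Fin; toℕ; fromℕ<)
import Data.Fin as Fin
import Data.Fin.Properties as FinP
open import Data.Vec using (Vec; []; _∷_; map; sum)
open import Data.Sum.Properties using (≡-dec)
open import Data.Sum using (_⊎_; inj₁; inj₂; [_,_]′)
open import Data.Product using (Σ; ∃; _×_; _,_; proj₁; proj₂)
open import Function using (_∘_)
open import Induction.WellFounded using (Acc; acc)
open import Data.Nat.Induction using (<-wellFounded)
open import Relation.Nullary using (Dec; yes; no; ¬_; contradiction)
open import Relation.Nullary.Decidable using (map′; _×-dec_; _⊎-dec_)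
open import Level using (0ℓ)
open import Relation.Binary using (DecidableEquality; Setoid)
import Relation.Binary.Reasoning.Setoid as SetoidReasoning
open import Relation.Binary.PropositionalEquality
open import Data.Parity.Base using (Parity; 0ℙ; 1ℙ; _⁻¹)
open import Data.Parity.Properties using (⁻¹-involutive; p≢p⁻¹) renaming (_≟_ to _≟ℙ_)

module _ {V : Set} {Adj : V → V → Set} where

  walk-snoc : ∀ {x y z ℓ} → Walk Adj x y ℓ → Adj y z → Walk Adj x z (suc ℓ)
  walk-snoc here        e = step e here
  walk-snoc (step e′ w) e = step e′ (walk-snoc w e)

  walk-reverse : (∀ {x y} → Adj x y → Adj y x) → ∀ {x y ℓ} → Walk Adj x y ℓ → Walk Adj y x ℓ
  walk-reverse sym-adj here       = here
  walk-reverse sym-adj (step e w) = walk-snoc (walk-reverse sym-adj w) (sym-adj e)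

  walk? : DecidableEquality V → (∀ x y → Dec (Adj x y)) →
          (∀ {P : V → Set} → (∀ v → Dec (P v)) → Dec (∃ P)) →
          ∀ ℓ x y → Dec (Walk Adj x y ℓ)
  walk? _≟_ adj? search zero x y = map′ (λ { refl → here }) (λ { here → refl }) (x ≟ y)
  walk? _≟_ adj? search (suc ℓ) x y =
    map′ (λ { (z , e , w) → step e w }) (λ { (step e w) → _ , e , w })
         (search (λ z → adj? x z ×-dec walk? _≟_ adj? search ℓ z y))

  distance≤ : ∀ {x y} → (∀ ℓ → Dec (Walk Adj x y ℓ)) →
              ∀ {ℓ} → Walk Adj x y ℓ → Σ ℕ λ d → IsDist Adj x y d × d ≤ ℓ
  distance≤ {x} {y} walk-of? w = shortest _ (<-wellFounded _) w
    where
    shortest : ∀ ℓ → Acc _<_ ℓ → Walk Adj x y ℓ → Σ ℕ λ d → IsDist Adj x y d × d ≤ ℓ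
    shortest ℓ (acc smaller) w with anyUpTo? walk-of? ℓ
    ... | yes (k , k<ℓ , w′) =
      let (d , dist , d≤k) = shortest k (smaller k<ℓ) w′ in d , dist , ≤-trans d≤k (<⇒≤ k<ℓ)
    ... | no none = ℓ , (w , λ k w′ → ≮⇒≥ (λ k<ℓ → none (k , k<ℓ , w′))) , ≤-refl

-- Sides of the bipartition: 0ℙ is U, 1ℙ is V.  A walk alternates sides, so after
-- ℓ steps from side s it is on side  sideAfter s ℓ.
sideAfter : Parity → ℕ → Parity
sideAfter s zero    = s
sideAfter s (suc ℓ) = sideAfter (s ⁻¹) ℓ

sideAfter-suc : ∀ s ℓ → sideAfter s (suc ℓ) ≡ sideAfter s ℓ ⁻¹
sideAfter-suc s zero    = refl
sideAfter-suc s (suc ℓ) = sideAfter-suc (s ⁻¹) ℓ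

sideAfter-involutive : ∀ s ℓ → sideAfter (sideAfter s ℓ) ℓ ≡ s
sideAfter-involutive s zero    = refl
sideAfter-involutive s (suc ℓ) = begin
  sideAfter (sideAfter (s ⁻¹) ℓ ⁻¹) ℓ  ≡⟨ sideAfter-suc (sideAfter (s ⁻¹) ℓ) ℓ ⟩
  sideAfter (sideAfter (s ⁻¹) ℓ) ℓ ⁻¹  ≡⟨ cong _⁻¹ (sideAfter-involutive (s ⁻¹) ℓ) ⟩
  s ⁻¹ ⁻¹                              ≡⟨ ⁻¹-involutive s ⟩
  s                                    ∎
  where open ≡-Reasoning

≢⇒opposite : ∀ p q → p ≢ q → p ≡ q ⁻¹
≢⇒opposite 0ℙ 0ℙ p≢q = contradiction refl p≢q
≢⇒opposite 0ℙ 1ℙ _   = refl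
≢⇒opposite 1ℙ 0ℙ _   = refl
≢⇒opposite 1ℙ 1ℙ p≢q = contradiction refl p≢q

-- Among the ℓ steps of a walk starting on side s, forwardSteps s ℓ go from U to V
-- and backwardSteps s ℓ go from V to U.
forwardSteps : Parity → ℕ → ℕ
forwardSteps 0ℙ ℓ = ⌈ ℓ /2⌉
forwardSteps 1ℙ ℓ = ⌊ ℓ /2⌋

backwardSteps : Parity → ℕ → ℕ
backwardSteps s = forwardSteps (s ⁻¹)

steps-total : ∀ s ℓ → forwardSteps s ℓ + backwardSteps s ℓ ≡ ℓ
steps-total 0ℙ ℓ = trans (+-comm ⌈ ℓ /2⌉ ⌊ ℓ /2⌋) (⌊n/2⌋+⌈n/2⌉≡n ℓ)
steps-total 1ℙ ℓ = ⌊n/2⌋+⌈n/2⌉≡n ℓ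

forwardSteps-2+ : ∀ s ℓ → forwardSteps s (suc (suc ℓ)) ≡ suc (forwardSteps s ℓ)
forwardSteps-2+ 0ℙ ℓ = refl
forwardSteps-2+ 1ℙ ℓ = refl

half≤forwardSteps : ∀ s ℓ → ⌊ ℓ /2⌋ ≤ forwardSteps s ℓ
half≤forwardSteps 0ℙ ℓ = ⌊n/2⌋≤⌈n/2⌉ ℓ
half≤forwardSteps 1ℙ ℓ = ≤-refl

-- Read backwards, a walk from side s exchanges its forward and backward steps.
backwardSteps-reversed : ∀ s ℓ → backwardSteps (sideAfter s ℓ) ℓ ≡ forwardSteps s ℓ
backwardSteps-reversed 0ℙ zero          = refl
backwardSteps-reversed 1ℙ zero          = refl
backwardSteps-reversed 0ℙ (suc zero)    = refl
backwardSteps-reversed 1ℙ (suc zero)    = refl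
backwardSteps-reversed 0ℙ (suc (suc ℓ)) =
  trans (forwardSteps-2+ (sideAfter 0ℙ ℓ ⁻¹) ℓ) (cong suc (backwardSteps-reversed 0ℙ ℓ))
backwardSteps-reversed 1ℙ (suc (suc ℓ)) =
  trans (forwardSteps-2+ (sideAfter 1ℙ ℓ ⁻¹) ℓ) (cong suc (backwardSteps-reversed 1ℙ ℓ))

-- Congruence of natural numbers modulo a fixed modulus m > 0.  It is a record so
-- that the two numbers can be inferred from a proof.
module Congruence (m : ℕ) .{{_ : NonZero m}} where

  infix 4 _≋_
  record _≋_ (x y : ℕ) : Set where
    constructor mod-eq
    field mod-≡ : x % m ≡ y % m
  open _≋_ public

  ≋-setoid : Setoid 0ℓ 0ℓ
  ≋-setoid = record
    { Carrier       = ℕ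
    ; _≈_           = _≋_
    ; isEquivalence = record
      { refl  = mod-eq refl
      ; sym   = λ (mod-eq e) → mod-eq (sym e)
      ; trans = λ (mod-eq e) (mod-eq e′) → mod-eq (trans e e′)
      }
    }

  open Setoid ≋-setoid public using () renaming (refl to ≋-refl; sym to ≋-sym; trans to ≋-trans)
  module ≋-Reasoning = SetoidReasoning ≋-setoid

  infix 4 _≋?_
  _≋?_ : ∀ x y → Dec (x ≋ y)
  x ≋? y = map′ mod-eq mod-≡ (x % m ≟ y % m)

  ≡⇒≋ : ∀ {x y} → x ≡ y → x ≋ y
  ≡⇒≋ e = mod-eq (cong (_% m) e)

  +-congʳ : ∀ {x y} z → x ≋ y → x + z ≋ y + z
  +-congʳ {x} {y} z (mod-eq e) = mod-eq (begin
    (x + z) % m            ≡⟨ %-distribˡ-+ x z m ⟩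
    (x % m + z % m) % m    ≡⟨ cong (λ r → (r + z % m) % m) e ⟩
    (y % m + z % m) % m    ≡⟨ %-distribˡ-+ y z m ⟨
    (y + z) % m            ∎)
    where open ≡-Reasoning

  +-congˡ : ∀ {x y} z → x ≋ y → z + x ≋ z + y
  +-congˡ {x} {y} z e = mod-eq (begin
    (z + x) % m  ≡⟨ cong (_% m) (+-comm z x) ⟩
    (x + z) % m  ≡⟨ mod-≡ (+-congʳ z e) ⟩
    (y + z) % m  ≡⟨ cong (_% m) (+-comm y z) ⟩
    (z + y) % m  ∎)
    where open ≡-Reasoning

  %-≋ : ∀ x → x % m ≋ x
  %-≋ x = mod-eq (m%n%n≡m%n x m)

  +multiple-≋ : ∀ x k → x + k * m ≋ x
  +multiple-≋ x k = mod-eq ([m+kn]%n≡m%n x k m)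

  +m-≋ : ∀ x → x + m ≋ x
  +m-≋ x = mod-eq ([m+n]%n≡m%n x m)

  ≋-canonical : ∀ {x y} → x < m → y < m → x ≋ y → x ≡ y
  ≋-canonical x<m y<m (mod-eq e) = trans (sym (m<n⇒m%n≡m x<m)) (trans e (m<n⇒m%n≡m y<m))

  -- Cancellation of a common summand: adding (m - 1) z to both sides turns z into
  -- the multiple z m.
  +-cancelʳ-≋ : ∀ {x y} z → x + z ≋ y + z → x ≋ y
  +-cancelʳ-≋ {x} {y} z e = begin
    x                      ≈⟨ +multiple-≋ x z ⟨
    x + z * m              ≡⟨ split x ⟩
    x + z + z * (m ∸ 1)    ≈⟨ +-congʳ (z * (m ∸ 1)) e ⟩
    y + z + z * (m ∸ 1)    ≡⟨ split y ⟨
    y + z * m              ≈⟨ +multiple-≋ y z ⟩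
    y                      ∎
    where
    open ≋-Reasoning
    split : ∀ w → w + z * m ≡ w + z + z * (m ∸ 1)
    split w = trans (cong (λ k → w + z * k) (sym (suc-pred m)))
                    (trans (cong (w +_) (*-suc z (m ∸ 1))) (sym (+-assoc w z (z * (m ∸ 1)))))

  ≋⇒multiple : ∀ {x y} → y < m → x ≋ y → Σ ℕ λ q → x ≡ q * m + y
  ≋⇒multiple {x} {y} y<m (mod-eq e) = x / m , (begin
    x                  ≡⟨ m≡m%n+[m/n]*n x m ⟩
    x % m + x / m * m  ≡⟨ cong (_+ x / m * m) (trans e (m<n⇒m%n≡m y<m)) ⟩
    y + x / m * m      ≡⟨ +-comm y (x / m * m) ⟩
    x / m * m + y      ∎)
    where open ≡-Reasoning

  multiple⇒≋ : ∀ {x y} q → x ≡ q * m + y → x ≋ y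
  multiple⇒≋ {x} {y} q e = ≋-trans (≡⇒≋ (trans e (+-comm (q * m) y))) (+multiple-≋ y q)

  offset : ∀ x y → y ≤ m → Σ ℕ λ e → e < m × x ≋ y + e
  offset x y y≤m = e , m%n<n (x + (m ∸ y)) m , ≋-sym (begin
    y + e              ≈⟨ +-congˡ y (%-≋ (x + (m ∸ y))) ⟩
    y + (x + (m ∸ y))  ≡⟨ +-comm y (x + (m ∸ y)) ⟩
    x + (m ∸ y) + y    ≡⟨ +-assoc x (m ∸ y) y ⟩
    x + (m ∸ y + y)    ≡⟨ cong (x +_) (m∸n+n≡m y≤m) ⟩
    x + m              ≈⟨ +m-≋ x ⟩
    x                  ∎)
    where
    open ≋-Reasoning
    e : ℕ
    e = (x + (m ∸ y)) % m

  residue : ∀ x → Σ (Fin m) λ r → x ≋ toℕ r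
  residue x = fromℕ< (m%n<n x m) , ≋-sym (≋-trans (≡⇒≋ (FinP.toℕ-fromℕ< (m%n<n x m))) (%-≋ x))

  residue-∸ : ∀ y a → a ≤ m → Σ (Fin m) λ r → toℕ r + a ≋ y
  residue-∸ y a a≤m with residue (y + (m ∸ a))
  ... | r , c = r , (begin
    toℕ r + a          ≈⟨ +-congʳ a c ⟨
    y + (m ∸ a) + a    ≡⟨ +-assoc y (m ∸ a) a ⟩
    y + (m ∸ a + a)    ≡⟨ cong (y +_) (m∸n+n≡m a≤m) ⟩
    y + m              ≈⟨ +m-≋ y ⟩
    y                  ∎)
    where open ≋-Reasoning

  ≋-complement : ∀ {x y a b e e′} → x + b ≋ y + e → e + e′ ≡ a + b → y + a ≋ x + e′
  ≋-complement {x} {y} {a} {b} {e} {e′} c total = +-cancelʳ-≋ b (begin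
    y + a + b     ≡⟨ +-assoc y a b ⟩
    y + (a + b)   ≡⟨ cong (y +_) total ⟨
    y + (e + e′)  ≡⟨ +-assoc y e e′ ⟨
    y + e + e′    ≈⟨ +-congʳ e′ c ⟨
    x + b + e′    ≡⟨ +-assoc x b e′ ⟩
    x + (b + e′)  ≡⟨ cong (x +_) (+-comm b e′) ⟩
    x + (e′ + b)  ≡⟨ +-assoc x e′ b ⟨
    x + e′ + b    ∎)
    where open ≋-Reasoning

-- The k-th class of edges of a Knödel graph joins u_i to v_(i + gap k).
gap : ℕ → ℕ
gap k = 2 ^ k ∸ 1

2^≡1+gap : ∀ k → 2 ^ k ≡ suc (gap k)
2^≡1+gap k = sym (m+[n∸m]≡n (m^n>0 2 k))

gap-suc : ∀ k → gap (suc k) ≡ suc (gap k + gap k)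
gap-suc k = begin
  2 * 2 ^ k ∸ 1          ≡⟨ cong (λ x → 2 * x ∸ 1) (2^≡1+gap k) ⟩
  2 * suc (gap k) ∸ 1    ≡⟨ double-suc (gap k) ⟩
  suc (gap k + gap k)    ∎
  where
  open ≡-Reasoning
  double-suc : ∀ g → 2 * suc g ∸ 1 ≡ suc (g + g)
  double-suc g = trans (+-suc g (g + 0)) (cong (λ x → suc (g + x)) (+-identityʳ g))

gap-mono : ∀ {j k} → j ≤ k → gap j ≤ gap k
gap-mono j≤k = ∸-monoˡ-≤ 1 (^-monoʳ-≤ 2 j≤k)

halve-≤ : ∀ {x y} → x + x ≤ y + y → x ≤ y
halve-≤ {x} {y} le = subst₂ _≤_ (sym (n≡⌊n+n/2⌋ x)) (sym (n≡⌊n+n/2⌋ y)) (⌊n/2⌋-mono le)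

-- One more summand from {0, x, y} extends the range of representable values from
-- [0, g] to [0, g + y], provided the summands leave no holes: x ≤ g + 1 and
-- y ≤ g + x + 1.  R E says E is representable, R′ E that it is with one more summand.
extend : ∀ {R R′ : ℕ → Set} g x y → x ≤ suc g → y ≤ suc (g + x) →
         (∀ {E} → R E → R′ E) → (∀ {E} → R E → R′ (x + E)) →
         (∀ {E} → R E → R′ (y + E)) →
         (∀ E → E ≤ g → R E) → ∀ E → E ≤ g + y → R′ E
extend {R′ = R′} g x y x≤1+g y≤1+g+x add0 addx addy rep E E≤g+y with E ≤? g
... | yes E≤g = add0 (rep E E≤g)
... | no  E≰g with y ≤? E
...   | yes y≤E = subst R′ (m+[n∸m]≡n y≤E)
                    (addy (rep (E ∸ y) (m≤n+o⇒m∸n≤o E y (subst (E ≤_) (+-comm g y) E≤g+y))))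
...   | no  y≰E = subst R′ (m+[n∸m]≡n (≤-trans x≤1+g (≰⇒> E≰g)))
                    (addx (rep (E ∸ x) (m≤n+o⇒m∸n≤o E x (subst (E ≤_) (+-comm g x) E≤g+x))))
  where
  E≤g+x : E ≤ g + x
  E≤g+x = s≤s⁻¹ (≤-trans (≰⇒> y≰E) y≤1+g+x)

-- Sums of gaps of the Knödel graph W_{K+2, n}: the gaps are gap 0 … gap (K+1),
-- the largest one is M = 2^(K+1) - 1 = 2G + 1 with G = gap K.  A backward step
-- with gap a contributes the complement M - a.
module Sums (K : ℕ) where

  Δ : ℕ
  Δ = suc (suc K)

  G M : ℕ
  G = gap K
  M = gap (suc K)

  cogap : ℕ → ℕ
  cogap j = M ∸ gap j

  gapSum : ∀ {p} → Vec (Fin Δ) p → ℕ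
  gapSum fs = sum (map (gap ∘ toℕ) fs)

  cogapSum : ∀ {r} → Vec (Fin Δ) r → ℕ
  cogapSum bs = sum (map (cogap ∘ toℕ) bs)

  Rep : ℕ → ℕ → ℕ → Set
  Rep p r E = Σ (Vec (Fin Δ) p) λ fs → Σ (Vec (Fin Δ) r) λ bs → gapSum fs + cogapSum bs ≡ E

  rep-forward : ∀ {p r E} j → j < Δ → Rep p r E → Rep (suc p) r (gap j + E)
  rep-forward j j<Δ (fs , bs , refl) = fromℕ< j<Δ ∷ fs , bs ,
    trans (cong (λ k → gap k + gapSum fs + cogapSum bs) (FinP.toℕ-fromℕ< j<Δ))
          (+-assoc (gap j) (gapSum fs) (cogapSum bs))

  rep-backward : ∀ {p r E} j → j < Δ → Rep p r E → Rep p (suc r) (cogap j + E)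
  rep-backward j j<Δ (fs , bs , refl) = fs , fromℕ< j<Δ ∷ bs ,
    trans (cong (λ k → gapSum fs + (cogap k + cogapSum bs)) (FinP.toℕ-fromℕ< j<Δ))
          (swap (gapSum fs) (cogap j) (cogapSum bs))
    where
    swap : ∀ x c y → x + (c + y) ≡ c + (x + y)
    swap = solve-∀

  M≡1+2G : M ≡ suc (G + G)
  M≡1+2G = gap-suc K

  K<Δ : K < Δ
  K<Δ = <-trans (n<1+n K) (n<1+n (suc K))

  1+K<Δ : suc K < Δ
  1+K<Δ = n<1+n (suc K)

  -- Every E ≤ 2^j - 1 (j < Δ) is a sum of exactly j gaps: binary expansion,
  -- where adding the gaps 0, 2^j - 1 and 2^(j+1) - 1 doubles the range.
  binaryRep : ∀ j → j < Δ → ∀ E → E ≤ gap j → Rep j 0 E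
  binaryRep zero    _    .zero z≤n = [] , [] , refl
  binaryRep (suc j) j<Δ  E     E≤  =
    extend (gap j) (gap j) (gap (suc j)) (n≤1+n (gap j)) (≤-reflexive (gap-suc j))
           (rep-forward 0 z<s) (rep-forward j (<-trans (n<1+n j) j<Δ)) (rep-forward (suc j) j<Δ)
           (binaryRep j (<-trans (n<1+n j) j<Δ)) E (≤-trans E≤ (m≤n+m (gap (suc j)) (gap j)))

  -- Once every E ≤ g (g ≥ G) is representable, one more forward step (gaps 0, G, M)
  -- or backward step (complements M, G + 1, 0) extends the range by M.
  extendForward : ∀ {p r} g → G ≤ g → (∀ E → E ≤ g → Rep p r E) →
                  ∀ E → E ≤ g + M → Rep (suc p) r E
  extendForward g G≤g =
    extend g G M (m≤n⇒m≤1+n G≤g)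
           (subst (_≤ suc (g + G)) (sym M≡1+2G) (s≤s (+-monoˡ-≤ G G≤g)))
           (rep-forward 0 z<s) (rep-forward K K<Δ) (rep-forward (suc K) 1+K<Δ)

  extendBackward : ∀ {p r} g → G ≤ g → (∀ E → E ≤ g → Rep p r E) →
                   ∀ E → E ≤ g + M → Rep p (suc r) E
  extendBackward {p} {r} g G≤g =
    extend g (suc G) M (s≤s G≤g)
           (subst (_≤ suc (g + suc G)) (sym M≡1+2G) (s≤s (+-mono-≤ G≤g (n≤1+n G))))
           (λ {E} rep → subst (λ c → Rep p (suc r) (c + E)) cogap-max (rep-backward (suc K) 1+K<Δ rep))
           (λ {E} rep → subst (λ c → Rep p (suc r) (c + E)) cogap-G (rep-backward K K<Δ rep))
           (rep-backward 0 z<s)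
    where
    cogap-max : cogap (suc K) ≡ 0
    cogap-max = n∸n≡0 M
    cogap-G : cogap K ≡ suc G
    cogap-G = trans (cong (_∸ G) M≡1+2G) (m+n∸n≡m (suc G) G)

  range-suc : ∀ n → G + suc n * M ≡ G + n * M + M
  range-suc n = shift G n M
    where
    shift : ∀ g n c → g + suc n * c ≡ g + n * c + c
    shift = solve-∀

  repBelow : ∀ p r E → E ≤ G + (p + r) * M → Rep (p + K) r E
  repBelow zero    zero    E E≤ = binaryRep K K<Δ E (subst (E ≤_) (+-identityʳ G) E≤)
  repBelow zero    (suc r) E E≤ =
    extendBackward (G + r * M) (m≤m+n G (r * M)) (repBelow zero r) E (subst (E ≤_) (range-suc r) E≤)
  repBelow (suc p) r       E E≤ =
    extendForward (G + (p + r) * M) (m≤m+n G ((p + r) * M)) (repBelow p r) E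
                  (subst (E ≤_) (range-suc (p + r)) E≤)

  -- If p ≥ K and p + r ≥ 2K, every E with 2E ≤ (p + r) M is a sum of p gaps and
  -- r complemented gaps: such E lie below (p - K + r) M.
  repHalf : ∀ p r → K ≤ p → K + K ≤ p + r → ∀ E → E + E ≤ (p + r) * M → Rep p r E
  repHalf p r K≤p 2K≤p+r E 2E≤ =
    subst (λ q → Rep q r E) (m∸n+n≡m K≤p) (repBelow p′ r E (≤-trans E≤X (m≤n+m X G)))
    where
    p′ X : ℕ
    p′ = p ∸ K
    X = (p′ + r) * M
    p+r≡ : p + r ≡ (p′ + r) + K
    p+r≡ = trans (cong (_+ r) (sym (m∸n+n≡m K≤p))) (rearrange p′ K r)
      where
      rearrange : ∀ a k b → a + k + b ≡ a + b + k
      rearrange = solve-∀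
    K≤p′+r : K ≤ p′ + r
    K≤p′+r = +-cancelʳ-≤ K K (p′ + r) (subst (K + K ≤_) p+r≡ 2K≤p+r)
    E≤X : E ≤ X
    E≤X = halve-≤ (begin
      E + E                        ≤⟨ 2E≤ ⟩
      (p + r) * M                  ≡⟨ cong (_* M) p+r≡ ⟩
      ((p′ + r) + K) * M           ≤⟨ *-monoˡ-≤ M (+-monoʳ-≤ (p′ + r) K≤p′+r) ⟩
      ((p′ + r) + (p′ + r)) * M    ≡⟨ *-distribʳ-+ M (p′ + r) (p′ + r) ⟩
      X + X                        ∎)
      where open ≤-Reasoning

  repSteps : ∀ s ℓ → K + K ≤ ℓ → ∀ {E} → E + E ≤ ℓ * M →
             Rep (forwardSteps s ℓ) (backwardSteps s ℓ) E
  repSteps s ℓ 2K≤ℓ {E} 2E≤ =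
    repHalf (forwardSteps s ℓ) (backwardSteps s ℓ) K≤forward
            (subst (K + K ≤_) (sym (steps-total s ℓ)) 2K≤ℓ) E
            (subst (λ x → E + E ≤ x * M) (sym (steps-total s ℓ)) 2E≤)
    where
    K≤forward : K ≤ forwardSteps s ℓ
    K≤forward = ≤-trans (≤-trans (≤-reflexive (n≡⌊n+n/2⌋ K)) (⌊n/2⌋-mono 2K≤ℓ))
                        (half≤forwardSteps s ℓ)

-- The Knödel graph W_{K+2, 2m} with m = m′ + 1; U-vertices are at (0ℙ, i) and
-- V-vertices at (1ℙ, j).
module Knödel (m′ K : ℕ) where

  open Sums K

  m : ℕ
  m = suc m′

  open Congruence m

  Adj : Vertex m → Vertex m → Set
  Adj = KAdj m Δ

  at : Parity → Fin m → Vertex m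
  at 0ℙ = inj₁
  at 1ℙ = inj₂

  at-injective : ∀ {s t i j} → at s i ≡ at t j → s ≡ t × i ≡ j
  at-injective {0ℙ} {0ℙ} refl = refl , refl
  at-injective {1ℙ} {1ℙ} refl = refl , refl
  at-injective {0ℙ} {1ℙ} ()
  at-injective {1ℙ} {0ℙ} ()

  every-vertex : ∀ {P : Vertex m → Set} → (∀ s i → P (at s i)) → ∀ x → P x
  every-vertex P-at (inj₁ i) = P-at 0ℙ i
  every-vertex P-at (inj₂ j) = P-at 1ℙ j

  adj-sym : ∀ {x y} → Adj x y → Adj y x
  adj-sym {inj₁ _} {inj₂ _} e = e
  adj-sym {inj₂ _} {inj₁ _} e = e

  gap≤M : ∀ k → k < Δ → gap k ≤ M
  gap≤M k k<Δ = gap-mono (s≤s⁻¹ k<Δ)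

  edge⇒≋ : ∀ {i j} → UVAdj m Δ i j → Σ ℕ λ k → k < Δ × toℕ i + gap k ≋ toℕ j
  edge⇒≋ (k , k<Δ , q , i+gap≡) = k , k<Δ , multiple⇒≋ q i+gap≡

  ≋⇒edge : ∀ {i j} k → k < Δ → toℕ i + gap k ≋ toℕ j → UVAdj m Δ i j
  ≋⇒edge {j = j} k k<Δ c = k , k<Δ , ≋⇒multiple (FinP.toℕ<n j) c

  adj? : ∀ x y → Dec (Adj x y)
  adj? (inj₁ i) (inj₂ j) = edge? i j
    where edge? : ∀ i j → Dec (UVAdj m Δ i j)
          edge? i j = map′ (λ (k , k<Δ , c) → ≋⇒edge k k<Δ c) edge⇒≋
                           (anyUpTo? (λ k → toℕ i + gap k ≋? toℕ j) Δ)
  adj? (inj₂ j) (inj₁ i) = adj? (inj₁ i) (inj₂ j)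
  adj? (inj₁ _) (inj₁ _) = no λ ()
  adj? (inj₂ _) (inj₂ _) = no λ ()

  vertex-search : ∀ {P : Vertex m → Set} → (∀ v → Dec (P v)) → Dec (∃ P)
  vertex-search {P} P? = map′ witness split (FinP.any? (P? ∘ inj₁) ⊎-dec FinP.any? (P? ∘ inj₂))
    where
    witness : (∃ (P ∘ inj₁)) ⊎ (∃ (P ∘ inj₂)) → ∃ P
    witness (inj₁ (i , Pi)) = inj₁ i , Pi
    witness (inj₂ (j , Pj)) = inj₂ j , Pj
    split : ∃ P → (∃ (P ∘ inj₁)) ⊎ (∃ (P ∘ inj₂))
    split (inj₁ i , Pi) = inj₁ (i , Pi)
    split (inj₂ j , Pj) = inj₂ (j , Pj)

  distance : ∀ {x y ℓ} → Walk Adj x y ℓ → Σ ℕ λ d → IsDist Adj x y d × d ≤ ℓ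
  distance {x} {y} = distance≤ (λ ℓ → walk? (≡-dec Fin._≟_ Fin._≟_) adj? vertex-search ℓ x y)

  -- The displacement invariant: a walk of length ℓ from (s, i) ends at some
  -- (sideAfter s ℓ, p) with  p + (backward steps) M ≋ i + E (mod m), E ≤ ℓ M,
  -- where E sums the gaps of forward steps and the complements of backward ones.
  record Displaced (s : Parity) (i : Fin m) (ℓ : ℕ) (w : Vertex m) : Set where
    constructor displaced
    field
      end       : Fin m
      at-end    : w ≡ at (sideAfter s ℓ) end
      shift     : ℕ
      shift≤    : shift ≤ ℓ * M
      congruent : toℕ end + backwardSteps s ℓ * M ≋ toℕ i + shift

  displacement : ∀ s {i w ℓ} → Walk Adj (at s i) w ℓ → Displaced s i ℓ w
  displacement 0ℙ {i} here = displaced i refl 0 z≤n ≋-refl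
  displacement 1ℙ {i} here = displaced i refl 0 z≤n ≋-refl
  displacement 0ℙ (step {y = inj₁ _} () _)
  displacement 1ℙ (step {y = inj₂ _} () _)
  displacement 0ℙ {i} {ℓ = suc ℓ} (step {y = inj₂ j} e w) with edge⇒≋ e | displacement 1ℙ w
  ... | k , k<Δ , i+a≋j | displaced p at-p E E≤ c =
    displaced p at-p (gap k + E) (+-mono-≤ (gap≤M k k<Δ) E≤) (begin
      toℕ p + ⌈ ℓ /2⌉ * M    ≈⟨ c ⟩
      toℕ j + E              ≈⟨ +-congʳ E i+a≋j ⟨
      toℕ i + gap k + E      ≡⟨ +-assoc (toℕ i) (gap k) E ⟩
      toℕ i + (gap k + E)    ∎)
    where open ≋-Reasoning
  displacement 1ℙ {j} {ℓ = suc ℓ} (step {y = inj₁ i} e w) with edge⇒≋ e | displacement 0ℙ w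
  ... | k , k<Δ , i+a≋j | displaced p at-p E E≤ c =
    displaced p at-p (cogap k + E) (+-mono-≤ (m∸n≤m M (gap k)) E≤) (begin
      toℕ p + (M + ⌊ ℓ /2⌋ * M)          ≡⟨ swap (toℕ p) M (⌊ ℓ /2⌋ * M) ⟩
      toℕ p + ⌊ ℓ /2⌋ * M + M            ≈⟨ +-congʳ M c ⟩
      toℕ i + E + M                      ≡⟨ cong (toℕ i + E +_) (m+[n∸m]≡n (gap≤M k k<Δ)) ⟨
      toℕ i + E + (gap k + cogap k)      ≡⟨ regroup (toℕ i) E (gap k) (cogap k) ⟩
      toℕ i + gap k + (cogap k + E)      ≈⟨ +-congʳ (cogap k + E) i+a≋j ⟩
      toℕ j + (cogap k + E)              ∎)
    where
    open ≋-Reasoning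
    swap : ∀ x y z → x + (y + z) ≡ x + z + y
    swap = solve-∀
    regroup : ∀ x e a b → x + e + (a + b) ≡ x + a + (b + e)
    regroup = solve-∀

  same-index : ∀ {i p : Fin m} → toℕ p + 0 ≋ toℕ i + 0 → i ≡ p
  same-index {i} {p} c = sym (FinP.toℕ-injective (≋-canonical (FinP.toℕ<n p) (FinP.toℕ<n i)
    (≋-trans (≡⇒≋ (sym (+-identityʳ (toℕ p)))) (≋-trans c (≡⇒≋ (+-identityʳ (toℕ i)))))))

  -- Conversely, when M < m every displacement allowed by a representation is
  -- realised by a walk: the gaps of the representation are used as the steps.
  module Realisation (M<m : M < m) where

    realise : ∀ s ℓ (i p : Fin m) {E} → Rep (forwardSteps s ℓ) (backwardSteps s ℓ) E →
              toℕ p + backwardSteps s ℓ * M ≋ toℕ i + E →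
              Walk Adj (at s i) (at (sideAfter s ℓ) p) ℓ
    realise 0ℙ zero i p ([] , [] , refl) c =
      subst (λ q → Walk Adj (inj₁ i) (inj₁ q) 0) (same-index c) here
    realise 1ℙ zero j p ([] , [] , refl) c =
      subst (λ q → Walk Adj (inj₂ j) (inj₂ q) 0) (same-index c) here
    realise 0ℙ (suc ℓ) i p (k ∷ fs , bs , refl) c =
      step (≋⇒edge (toℕ k) (FinP.toℕ<n k) i+a≋j) (realise 1ℙ ℓ j p (fs , bs , refl) (begin
        toℕ p + ⌈ ℓ /2⌉ * M    ≈⟨ c ⟩
        toℕ i + (a + F + B)    ≡⟨ regroup (toℕ i) a F B ⟩
        toℕ i + a + (F + B)    ≈⟨ +-congʳ (F + B) i+a≋j ⟩
        toℕ j + (F + B)        ∎))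
      where
      open ≋-Reasoning
      a F B : ℕ
      a = gap (toℕ k)
      F = gapSum fs
      B = cogapSum bs
      j : Fin m
      j = proj₁ (residue (toℕ i + a))
      i+a≋j : toℕ i + a ≋ toℕ j
      i+a≋j = proj₂ (residue (toℕ i + a))
      regroup : ∀ x a f b → x + (a + f + b) ≡ x + a + (f + b)
      regroup = solve-∀
    realise 1ℙ (suc ℓ) j p (fs , k ∷ bs , refl) c =
      step (≋⇒edge (toℕ k) (FinP.toℕ<n k) i+a≋j)
           (realise 0ℙ ℓ i p (fs , bs , refl) (+-cancelʳ-≋ M (begin
        toℕ p + ⌊ ℓ /2⌋ * M + M            ≡⟨ swap (toℕ p) (⌊ ℓ /2⌋ * M) M ⟩
        toℕ p + (M + ⌊ ℓ /2⌋ * M)          ≈⟨ c ⟩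
        toℕ j + (F + (b + B))              ≈⟨ +-congʳ (F + (b + B)) i+a≋j ⟨
        toℕ i + a + (F + (b + B))          ≡⟨ regroup (toℕ i) a b F B ⟩
        toℕ i + (F + B) + (a + b)          ≡⟨ cong (toℕ i + (F + B) +_) (m+[n∸m]≡n a≤M) ⟩
        toℕ i + (F + B) + M                ∎)))
      where
      open ≋-Reasoning
      a b F B : ℕ
      a = gap (toℕ k)
      b = cogap (toℕ k)
      F = gapSum fs
      B = cogapSum bs
      a≤M : a ≤ M
      a≤M = gap≤M (toℕ k) (FinP.toℕ<n k)
      i : Fin m
      i = proj₁ (residue-∸ (toℕ j) a (≤-trans a≤M (<⇒≤ M<m)))
      i+a≋j : toℕ i + a ≋ toℕ j
      i+a≋j = proj₂ (residue-∸ (toℕ j) a (≤-trans a≤M (<⇒≤ M<m)))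
      swap : ∀ x y z → x + y + z ≡ x + (z + y)
      swap = solve-∀
      regroup : ∀ x a b f r → x + a + (f + (b + r)) ≡ x + (f + r) + (a + b)
      regroup = solve-∀

    -- The needed displacement e < m is realised
    -- directly if 2e ≤ ℓ M; otherwise the complement ℓ M - e is realised backwards.
    reach : ∀ s ℓ → K + K ≤ ℓ → m ≤ suc (ℓ * M) → ∀ i p →
            Walk Adj (at s i) (at (sideAfter s ℓ) p) ℓ
    reach s ℓ 2K≤ℓ m≤ i p
      with offset (toℕ p + backwardSteps s ℓ * M) (toℕ i) (<⇒≤ (FinP.toℕ<n i))
    ... | e , e<m , c with e + e ≤? ℓ * M
    ...   | yes 2e≤ = realise s ℓ i p (repSteps s ℓ 2K≤ℓ 2e≤) c
    ...   | no  2e≰ = walk-reverse adj-sym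
                        (subst (λ t → Walk Adj (at s′ p) (at t i) ℓ) (sideAfter-involutive s ℓ)
                               (realise s′ ℓ p i (repSteps s′ ℓ 2K≤ℓ 2e′≤) c′))
      where
      s′ : Parity
      s′ = sideAfter s ℓ
      e′ : ℕ
      e′ = ℓ * M ∸ e
      e≤ℓM : e ≤ ℓ * M
      e≤ℓM = s≤s⁻¹ (≤-trans e<m m≤)
      e+e′ : e + e′ ≡ forwardSteps s ℓ * M + backwardSteps s ℓ * M
      e+e′ = trans (m+[n∸m]≡n e≤ℓM)
                   (trans (cong (_* M) (sym (steps-total s ℓ)))
                          (*-distribʳ-+ M (forwardSteps s ℓ) (backwardSteps s ℓ)))
      2e′≤ : e′ + e′ ≤ ℓ * M
      2e′≤ = ≤-trans (+-monoˡ-≤ e′ (m≤n+o⇒m∸n≤o (ℓ * M) e (<⇒≤ (≰⇒> 2e≰))))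
                     (≤-reflexive (m+[n∸m]≡n e≤ℓM))
      c′ : toℕ i + backwardSteps s′ ℓ * M ≋ toℕ p + e′
      c′ = subst (λ n → toℕ i + n * M ≋ toℕ p + e′) (sym (backwardSteps-reversed s ℓ))
                 (≋-complement {x = toℕ p} {y = toℕ i} c e+e′)

  -- The diameter of W_{K+2, 2m} is c + 1 when M < m, c is the ceiling of (m - 1)/M
  -- (m - 1 ≤ c M < m - 1 + M) and c ≥ 2K.
  module Diameter (M<m : M < m) (c : ℕ) (m′≤cM : m′ ≤ c * M) (cM<m′+M : c * M < m′ + M)
                  (2K≤c : K + K ≤ c) where

    open Realisation M<m

    m≤1+[1+c]M : m ≤ suc (suc c * M)
    m≤1+[1+c]M = s≤s (≤-trans m′≤cM (m≤n+m (c * M) M))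

    -- Any two vertices are joined by a walk of length c or c + 1, according to
    -- their sides.
    within : ∀ s i t p → Σ ℕ λ d → IsDist Adj (at s i) (at t p) d × d ≤ suc c
    within s i t p with t ≟ℙ sideAfter s c
    ... | yes refl =
      let (d , dist , d≤c) = distance (reach s c 2K≤c (s≤s m′≤cM) i p)
      in  d , dist , m≤n⇒m≤1+n d≤c
    ... | no  t≢ = subst (λ u → Σ ℕ λ d → IsDist Adj (at s i) (at u p) d × d ≤ suc c) t≡
                     (distance (reach s (suc c) (m≤n⇒m≤1+n 2K≤c) m≤1+[1+c]M i p))
      where
      t≡ : sideAfter s (suc c) ≡ t
      t≡ = trans (sideAfter-suc s c) (sym (≢⇒opposite t (sideAfter s c) t≢))

    -- The far vertex lies on the side reached after c + 1 steps from u_0, at index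
    -- Z = ⌊c/2⌋ M + 1.  A walk of length ℓ < c from u_0 to it would need a shift E ≤ ℓ M
    -- with Z + ⌊ℓ/2⌋ M ≋ E; but Z + ⌊ℓ/2⌋ M is a residue exceeding every such E.
    Z : ℕ
    Z = suc (⌊ c /2⌋ * M)

    short-target<m : ∀ ℓ → suc ℓ ≤ c → Z + ⌊ ℓ /2⌋ * M < m
    short-target<m ℓ ℓ<c = s≤s (+-cancelʳ-≤ M _ m′ (begin
      Z + ⌊ ℓ /2⌋ * M + M                  ≡⟨ collect (⌊ c /2⌋) (⌊ ℓ /2⌋) M ⟩
      suc ((⌊ c /2⌋ + suc ⌊ ℓ /2⌋) * M)    ≤⟨ s≤s (*-monoˡ-≤ M (+-monoʳ-≤ ⌊ c /2⌋ 1+⌊ℓ/2⌋≤⌈c/2⌉)) ⟩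
      suc ((⌊ c /2⌋ + ⌈ c /2⌉) * M)        ≡⟨ cong (λ n → suc (n * M)) (⌊n/2⌋+⌈n/2⌉≡n c) ⟩
      suc (c * M)                          ≤⟨ cM<m′+M ⟩
      m′ + M                               ∎))
      where
      open ≤-Reasoning
      1+⌊ℓ/2⌋≤⌈c/2⌉ : suc ⌊ ℓ /2⌋ ≤ ⌈ c /2⌉
      1+⌊ℓ/2⌋≤⌈c/2⌉ = ⌊n/2⌋-mono (s≤s ℓ<c)
      collect : ∀ a b x → suc (a * x) + b * x + x ≡ suc ((a + suc b) * x)
      collect = solve-∀

    short-shift<target : ∀ ℓ E → suc ℓ ≤ c → E ≤ ℓ * M → E < Z + ⌊ ℓ /2⌋ * M
    short-shift<target ℓ E ℓ<c E≤ = s≤s (begin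
      E                                  ≤⟨ E≤ ⟩
      ℓ * M                              ≡⟨ cong (_* M) (steps-total 0ℙ ℓ) ⟨
      (⌈ ℓ /2⌉ + ⌊ ℓ /2⌋) * M            ≡⟨ *-distribʳ-+ M ⌈ ℓ /2⌉ ⌊ ℓ /2⌋ ⟩
      ⌈ ℓ /2⌉ * M + ⌊ ℓ /2⌋ * M          ≤⟨ +-monoˡ-≤ (⌊ ℓ /2⌋ * M) (*-monoˡ-≤ M ⌈ℓ/2⌉≤⌊c/2⌋) ⟩
      ⌊ c /2⌋ * M + ⌊ ℓ /2⌋ * M          ∎)
      where
      open ≤-Reasoning
      ⌈ℓ/2⌉≤⌊c/2⌋ : ⌈ ℓ /2⌉ ≤ ⌊ c /2⌋
      ⌈ℓ/2⌉≤⌊c/2⌋ = ⌊n/2⌋-mono ℓ<c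

    -- c = 0 would force m = 1, contradicting 1 ≤ M < m.
    0<c : 0 < c
    0<c = n≢0⇒n>0 λ c≡0 → <⇒≱ (subst (0 <_) (sym M≡1+2G) z<s)
            (s≤s⁻¹ (≤-trans M<m (s≤s (subst (λ n → m′ ≤ n * M) c≡0 m′≤cM))))

    Z<m : Z < m
    Z<m = subst (_< m) (+-identityʳ Z) (short-target<m 0 0<c)

    z : Fin m
    z = fromℕ< Z<m

    far : Vertex m
    far = at (sideAfter 0ℙ (suc c)) z

    -- Walks of length ℓ ≤ c from u_0 cannot end at the far vertex: for ℓ = c the side
    -- is wrong, for ℓ < c the displacement is too small.
    too-short : ∀ ℓ → ℓ ≤ c → ¬ Displaced 0ℙ Fin.zero ℓ far
    too-short ℓ ℓ≤c (displaced p at-p E E≤ congr) =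
      [ (λ ℓ<c → too-small ℓ<c (subst (λ n → n + ⌊ ℓ /2⌋ * M ≋ E) toℕ-p≡Z congr))
      , (λ ℓ≡c → p≢p⁻¹ (sideAfter 0ℙ c)
                   (trans (cong (sideAfter 0ℙ) (sym ℓ≡c)) (trans (sym sides) (sideAfter-suc 0ℙ c))))
      ]′ (m≤n⇒m<n∨m≡n ℓ≤c)
      where
      sides : sideAfter 0ℙ (suc c) ≡ sideAfter 0ℙ ℓ
      sides = proj₁ (at-injective at-p)
      toℕ-p≡Z : toℕ p ≡ Z
      toℕ-p≡Z = trans (cong toℕ (sym (proj₂ (at-injective at-p)))) (FinP.toℕ-fromℕ< Z<m)
      too-small : suc ℓ ≤ c → ¬ (Z + ⌊ ℓ /2⌋ * M ≋ E)
      too-small ℓ<c target≋E = <-irrefl (sym target≡E) E<target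
        where
        E<target : E < Z + ⌊ ℓ /2⌋ * M
        E<target = short-shift<target ℓ E ℓ<c E≤
        target<m : Z + ⌊ ℓ /2⌋ * M < m
        target<m = short-target<m ℓ ℓ<c
        target≡E : Z + ⌊ ℓ /2⌋ * M ≡ E
        target≡E = ≋-canonical target<m (<-trans E<target target<m) target≋E

    lowerBound : ∀ ℓ → Walk Adj (at 0ℙ Fin.zero) far ℓ → suc c ≤ ℓ
    lowerBound ℓ w = ≮⇒≥ λ ℓ<1+c → too-short ℓ (s≤s⁻¹ ℓ<1+c) (displacement 0ℙ w)

    far-distance : IsDist Adj (at 0ℙ Fin.zero) far (suc c)
    far-distance = exact (distance (reach 0ℙ (suc c) (m≤n⇒m≤1+n 2K≤c) m≤1+[1+c]M Fin.zero z))
      where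
      exact : (Σ ℕ λ d → IsDist Adj (at 0ℙ Fin.zero) far d × d ≤ suc c) →
              IsDist Adj (at 0ℙ Fin.zero) far (suc c)
      exact (d , (w , shortest) , d≤) =
        subst (IsDist Adj (at 0ℙ Fin.zero) far) (≤-antisym d≤ (lowerBound d w)) (w , shortest)

    diameter : IsDiameter Adj (suc c)
    diameter = every-vertex (λ s i → every-vertex (λ t p → within s i t p)) ,
               at 0ℙ Fin.zero , far , far-distance

ceilDiv-bounds : ∀ a b → 0 < b → a ≤ ceilDiv a b * b × ceilDiv a b * b < a + b
ceilDiv-bounds a (suc b) _ = lower , upper
  where
  c : ℕ
  c = (a + b) / suc b
  upper : c * suc b < a + suc b
  upper = subst (c * suc b <_) (sym (+-suc a b)) (s≤s (m/n*n≤m (a + b) (suc b)))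
  lower : a ≤ c * suc b
  lower = +-cancelʳ-≤ b a (c * suc b) (begin
    a + b                        ≡⟨ m≡m%n+[m/n]*n (a + b) (suc b) ⟩
    (a + b) % suc b + c * suc b  ≤⟨ +-monoˡ-≤ (c * suc b) (s≤s⁻¹ (m%n<n (a + b) (suc b))) ⟩
    b + c * suc b                ≡⟨ +-comm b (c * suc b) ⟩
    c * suc b + b                ∎)
    where open ≤-Reasoning

ceilDiv-double-bounds : ∀ a b M → b ≡ M * 2 → 0 < M →
                        a ≤ ceilDiv (a * 2) b * M × ceilDiv (a * 2) b * M < a + M
ceilDiv-double-bounds a .(M * 2) M@(suc _) refl _ with ceilDiv-bounds (a * 2) (M * 2) z<s
... | lower , upper =
  *-cancelʳ-≤ a (c * M) 2 (subst (a * 2 ≤_) (sym (*-assoc c M 2)) lower) ,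
  *-cancelʳ-< 2 (c * M) (a + M)
    (subst₂ _<_ (sym (*-assoc c M 2)) (sym (*-distribʳ-+ 2 a M)) upper)
  where
  c : ℕ
  c = ceilDiv (a * 2) (M * 2)

2^Δ≡[1+M]*2 : ∀ K → 2 ^ suc (suc K) ≡ suc (gap (suc K)) * 2
2^Δ≡[1+M]*2 K = trans (cong (2 *_) (2^≡1+gap (suc K))) (*-comm 2 (suc (gap (suc K))))

-- The hypotheses of Theorem 16 for Δ = t + 3 and n = 2m, m = m′ + 1, give the
-- parameters of Knödel.Diameter with K = t + 1 and c = ⌈(n - 2)/(2^Δ - 2)⌉.
module Parameters (t m′ : ℕ) where

  K : ℕ
  K = suc t

  open Sums K

  c : ℕ
  c = ceilDiv (m′ * 2) (2 ^ Δ ∸ 2)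

  2^Δ∸2≡2M : 2 ^ Δ ∸ 2 ≡ M * 2
  2^Δ∸2≡2M = cong (_∸ 2) (2^Δ≡[1+M]*2 K)

  M<m : 2 ^ Δ ≤ suc m′ * 2 → M < suc m′
  M<m 2^Δ≤n = *-cancelʳ-≤ (suc M) (suc m′) 2 (subst (_≤ suc m′ * 2) (2^Δ≡[1+M]*2 K) 2^Δ≤n)

  c-bounds : m′ ≤ c * M × c * M < m′ + M
  c-bounds = ceilDiv-double-bounds m′ (2 ^ Δ ∸ 2) M 2^Δ∸2≡2M (subst (0 <_) (sym M≡1+2G) z<s)

  2Δ∸5≡t+K : 2 * Δ ∸ 5 ≡ t + K
  2Δ∸5≡t+K = trans (cong (_∸ 5) (expand t)) (m+n∸m≡n 5 (t + K))
    where
    expand : ∀ u → 2 * suc (suc (suc u)) ≡ 5 + (u + suc u)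
    expand = solve-∀

  2K≤c : (2 * Δ ∸ 5) * (2 ^ Δ ∸ 2) + 4 ≤ suc m′ * 2 → K + K ≤ c
  2K≤c bound = *-cancelʳ-< M (t + K) c (≤-trans [t+K]M<m′ (proj₁ c-bounds))
    where
    regroup : ∀ x y → suc (suc (x * y)) * 2 ≡ x * (y * 2) + 4
    regroup = solve-∀
    [t+K]M<m′ : (t + K) * M < m′
    [t+K]M<m′ = s≤s⁻¹ (*-cancelʳ-≤ (suc (suc ((t + K) * M))) (suc m′) 2 (begin
      suc (suc ((t + K) * M)) * 2       ≡⟨ regroup (t + K) M ⟩
      (t + K) * (M * 2) + 4             ≡⟨ cong₂ (λ x y → x * y + 4) 2Δ∸5≡t+K 2^Δ∸2≡2M ⟨
      (2 * Δ ∸ 5) * (2 ^ Δ ∸ 2) + 4     ≤⟨ bound ⟩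
      suc m′ * 2                        ∎))
      where open ≤-Reasoning

mainTheorem16 : (Δ n : ℕ) → 2 ∣ n → 3 ≤ Δ → 2 ^ Δ ≤ n →
    (2 * Δ ∸ 5) * (2 ^ Δ ∸ 2) + 4 ≤ n →
    IsDiameter (KAdj (n / 2) Δ) (1 + ceilDiv (n ∸ 2) (2 ^ Δ ∸ 2))
mainTheorem16 zero                   _ _ ()                   _ _
mainTheorem16 (suc zero)             _ _ (s≤s ())             _ _
mainTheorem16 (suc (suc zero))       _ _ (s≤s (s≤s ()))       _ _
mainTheorem16 Δ@(suc (suc (suc _))) .(zero * 2) (divides zero refl) _ 2^Δ≤0 _ =
  contradiction 2^Δ≤0 (<⇒≱ (m^n>0 2 Δ))
mainTheorem16 Δ@(suc (suc (suc t))) .(suc m′ * 2) (divides (suc m′) refl) _ 2^Δ≤n bound =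
  subst (λ m → IsDiameter (KAdj m Δ) (suc c)) (sym (m*n/n≡m (suc m′) 2))
        (Diameter.diameter (M<m 2^Δ≤n) c (proj₁ c-bounds) (proj₂ c-bounds) (2K≤c bound))
  where
  open Parameters t m′
  open Knödel m′ K using (module Diameter)
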